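{- Let $G$ be a bridgeless cubic graph and let $E_0\subseteq E(G)$. Let $H$ be the cubic graph obtained from $G$ as follows: for every edge $e=uv\in E_0$, subdivide $e$ by a new vertex $w_e$, add a new copy of the graph $W$, and join the unique degree-two vertex of this copy of $W$ to $w_e$. Then \[ t(H)\leq \min_M |E_0\cap M|, \] where the minimum is taken over all perfect matchings $M$ of $G$.
   Context: Graphs are finite and loopless but may have parallel edges. A cubic graph is one in which every vertex has degree $3$. $W$ is the graph on three vertices $a,b,c$ with edges $ab$, $ac$ and two parallel edges between $b$ and $c$ (a triangle with one edge doubled); $a$ is its unique vertex of degree two. For a cubic graph $G$ and $U\subseteq V(G)$, $G_U$ denotes the cubic graph obtained from $G$ by expanding every vertex of $U$ into a triangle: a vertex $v$ with incident edges $e_1,e_2,e_3$ is replaced by three new mutually adjacent vertices $v_1,v_2,v_3$, with $e_i$ now incident to $v_i$ instead of $v$. $t(G)$ is the minimum size of a set $U\subseteq V(G)$ such that $G_U$ has a perfect matching. -}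

module Defs where

open import Data.Nat using (ℕ; zero; suc; _+_; _*_; _≤_; _<ᵇ_)
open import Data.Bool using (Bool; true; false; _∧_; _∨_; if_then_else_)
open import Data.Fin using (Fin; zero; suc; toℕ; _↑ˡ_; _↑ʳ_; combine; remQuot; splitAt; _≟_)
open import Data.Maybe using (Maybe; just; nothing)
open import Data.Product using (Σ; _×_; _,_; proj₁; proj₂)
open import Data.Sum using (_⊎_; inj₁; inj₂)
open import Data.Empty using (⊥)
open import Relation.Nullary using (yes; no)
import Data.Maybe as Maybe
open import Relation.Binary.PropositionalEquality using (_≡_; _≢_)
open import Relation.Nullary.Decidable using (⌊_⌋)
open import Function.Definitions using (Injective)

-- Multigraphs (parallel edges allowed).  Vertices are Fin nV, edges are
-- Fin nE, and every edge has an (unordered) pair of ends.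

record Graph : Set where
  constructor graph
  field
    nV   : ℕ
    nE   : ℕ
    ends : Fin nE → Fin nV × Fin nV

open Graph public

count : ∀ {n} → (Fin n → Bool) → ℕ
count {zero}  p = 0
count {suc n} p = (if p zero then 1 else 0) + count (λ i → p (suc i))

Loopless : Graph → Set
Loopless G = ∀ e → proj₁ (ends G e) ≢ proj₂ (ends G e)

incident : (G : Graph) → Fin (nV G) → Fin (nE G) → Bool
incident G v e = ⌊ proj₁ (ends G e) ≟ v ⌋ ∨ ⌊ proj₂ (ends G e) ≟ v ⌋

degree : (G : Graph) → Fin (nV G) → ℕ
degree G v = count (incident G v)

Cubic : Graph → Set
Cubic G = Loopless G × (∀ v → degree G v ≡ 3)

data ReachAvoiding (G : Graph) (f : Fin (nE G)) : Fin (nV G) → Fin (nV G) → Set where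
  here : ∀ {u} → ReachAvoiding G f u u
  step : ∀ {u w v} (e : Fin (nE G)) → e ≢ f →
         ((ends G e ≡ (u , w)) ⊎ (ends G e ≡ (w , u))) →
         ReachAvoiding G f w v → ReachAvoiding G f u v

IsBridge : (G : Graph) → Fin (nE G) → Set
IsBridge G e = ReachAvoiding G e (proj₁ (ends G e)) (proj₂ (ends G e)) → ⊥

Bridgeless : Graph → Set
Bridgeless G = ∀ e → IsBridge G e → ⊥

PerfectMatching : (G : Graph) → (Fin (nE G) → Bool) → Set
PerfectMatching G M = ∀ v → count (λ e → M e ∧ incident G v e) ≡ 1

HasPerfectMatching : Graph → Set
HasPerfectMatching G = Σ (Fin (nE G) → Bool) (PerfectMatching G)

preimage : ∀ {k n} → (Fin k → Fin n) → Fin n → Maybe (Fin k)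
preimage {zero}  g x = nothing
preimage {suc k} g x with g zero ≟ x
... | yes _ = just zero
... | no  _ = Maybe.map suc (preimage (λ i → g (suc i)) x)

-- G_U : expansion of the vertices of U into triangles.
-- A subset U of V(G) with |U| = j is given by an injective map
-- g : Fin j → Fin (nV G).  Vertices of G_U: Fin nV ⊎ (Fin j × Fin 2),
-- where for u = g i the triangle is u₁ = u, u₂ = (i,0), u₃ = (i,1).
-- The edges incident with u are numbered 1,2,3 in increasing order of
-- edge index (position = number of smaller-indexed edges at u), and the
-- i-th is re-attached to u_i.  Edges: Fin nE ⊎ (Fin j × Fin 3) where
-- (i,0),(i,1),(i,2) are the triangle edges u₁u₂, u₁u₃, u₂u₃.

position : (G : Graph) → Fin (nV G) → Fin (nE G) → ℕ
position G x e = count (λ e' → (toℕ e' <ᵇ toℕ e) ∧ incident G x e')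

expand : (G : Graph) (j : ℕ) → (Fin j → Fin (nV G)) → Graph
expand G j g = graph (nV G + j * 2) (nE G + j * 3) ends'
  where
  V' = Fin (nV G + j * 2)
  old : Fin (nV G) → V'
  old x = x ↑ˡ (j * 2)
  new : Fin j → Fin 2 → V'
  new i t = nV G ↑ʳ combine i t
  attach : Fin (nE G) → Fin (nV G) → V'
  attach e x with preimage g x
  ... | nothing = old x
  ... | just i with position G x e
  ...   | zero        = old x
  ...   | suc zero    = new i zero
  ...   | suc (suc _) = new i (suc zero)
  tri : Fin j → Fin 3 → V' × V'
  tri i zero             = old (g i) , new i zero
  tri i (suc zero)       = old (g i) , new i (suc zero)
  tri i (suc (suc _))    = new i zero , new i (suc zero)
  ends' : Fin (nE G + j * 3) → V' × V'
  ends' e with splitAt (nE G) e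
  ... | inj₁ e₀ = attach e₀ (proj₁ (ends G e₀)) , attach e₀ (proj₂ (ends G e₀))
  ... | inj₂ c  = tri (proj₁ (remQuot {j} 3 c)) (proj₂ (remQuot {j} 3 c))

-- t(G) ≤ m : there is U ⊆ V(G) with |U| ≤ m such that G_U has a perfect
-- matching (t(G) is the minimum such |U|).  U is given by an injective
-- map g : Fin j → V(G), so |U| = j.

t≤ : Graph → ℕ → Set
t≤ G m = Σ ℕ λ j → j ≤ m × Σ (Fin j → Fin (nV G)) λ g →
           Injective _≡_ _≡_ g × HasPerfectMatching (expand G j g)

-- E₀ ⊆ E(G) with |E₀| = k is given by an injective map
-- f : Fin k → Fin (nE G).  For the edge e = f i with ends (u , v):
--   vertices (i,0) = w_e, (i,1) = a, (i,2) = b, (i,3) = c  (copy of W),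
--   edge e itself becomes u w_e, and new edges
--   (i,0) = w_e v, (i,1) = w_e a, (i,2) = a b, (i,3) = a c,
--   (i,4) = b c, (i,5) = b c  (the doubled edge of W).

buildH : (G : Graph) (k : ℕ) → (Fin k → Fin (nE G)) → Graph
buildH G k f = graph (nV G + k * 4) (nE G + k * 6) ends'
  where
  V' = Fin (nV G + k * 4)
  old : Fin (nV G) → V'
  old x = x ↑ˡ (k * 4)
  new : Fin k → Fin 4 → V'
  new i t = nV G ↑ʳ combine i t
  w a b c : Fin k → V'
  w i = new i zero
  a i = new i (suc zero)
  b i = new i (suc (suc zero))
  c i = new i (suc (suc (suc zero)))
  oldEdge : Fin (nE G) → V' × V'
  oldEdge e with preimage f e
  ... | nothing = old (proj₁ (ends G e)) , old (proj₂ (ends G e))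
  ... | just i  = old (proj₁ (ends G e)) , w i
  newEdge : Fin k → Fin 6 → V' × V'
  newEdge i zero                               = w i , old (proj₂ (ends G (f i)))
  newEdge i (suc zero)                         = w i , a i
  newEdge i (suc (suc zero))                   = a i , b i
  newEdge i (suc (suc (suc zero)))             = a i , c i
  newEdge i (suc (suc (suc (suc zero))))       = b i , c i
  newEdge i (suc (suc (suc (suc (suc _)))))    = b i , c i
  ends' : Fin (nE G + k * 6) → V' × V'
  ends' e with splitAt (nE G) e
  ... | inj₁ e₀ = oldEdge e₀
  ... | inj₂ d  = newEdge (proj₁ (remQuot {k} 6 d)) (proj₂ (remQuot {k} 6 d))

countIn : ∀ {k n} → (Fin k → Fin n) → (Fin n → Bool) → ℕ
countIn f M = count (λ i → M (f i))

{-# OPTIONS --safe #-}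
-- Extend M to H: keep its edges (the edge e = uv of E₀ now being u w_e), add w_e v when e ∈ M,
-- and in every copy of W add w_e a and one of the parallel edges bc. This covers every vertex
-- exactly once, except the vertices w_e with e ∈ E₀ ∩ M, which are covered by all three of
-- their edges. Expanding exactly these vertices into triangles, each of the three edges lands
-- on its own triangle vertex, and the edge set becomes a perfect matching of H_U.
module Submission where

open import Defs
open import Data.Nat using (ℕ; zero; suc; _+_; _*_; _<ᵇ_)
open import Data.Nat.Properties using (≤-antisym; ≤-refl)
open import Data.Bool using (Bool; true; false; _∧_)
open import Data.Bool.Properties using (∧-conicalˡ; ∧-conicalʳ)
open import Data.Fin.Patterns using (0F; 1F; 2F; 3F; 4F; 5F)
open import Data.Fin using (Fin; zero; suc; toℕ; cast; _↑ˡ_; _↑ʳ_; combine; remQuot; quotRem; splitAt; join; _≟_)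
open import Data.Fin.Properties using (suc-injective; injective⇒≤; toℕ-cast; cast-involutive; splitAt-↑ˡ; splitAt-↑ʳ; join-splitAt; remQuot-combine; combine-remQuot; ↑ˡ-injective; ↑ʳ-injective; combine-injective)
open import Data.Maybe using (just; nothing)
open import Data.Product using (Σ; _×_; _,_; proj₁; proj₂; uncurry; swap)
open import Data.Sum using (_⊎_; inj₁; inj₂; [_,_]′)
import Data.Sum as Sum
open import Data.Empty using (⊥; ⊥-elim)
open import Data.Unit using (tt)
open import Relation.Unary using (U)
open import Relation.Nullary using (yes; no)
open import Relation.Binary.PropositionalEquality
open import Function using (_∘_; id)
open import Function.Definitions using (Injective)

enum : ∀ {n} (p : Fin n → Bool) → Fin (count p) → Fin n
enum {suc n} p l with p zero
enum {suc n} p zero    | true = zero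
enum {suc n} p (suc l) | true = suc (enum (λ i → p (suc i)) l)
enum {suc n} p l       | false = suc (enum (λ i → p (suc i)) l)

enum-satisfies : ∀ {n} (p : Fin n → Bool) l → p (enum p l) ≡ true
enum-satisfies {suc n} p l with p zero in eq
enum-satisfies {suc n} p zero    | true = eq
enum-satisfies {suc n} p (suc l) | true = enum-satisfies (λ i → p (suc i)) l
enum-satisfies {suc n} p l       | false = enum-satisfies (λ i → p (suc i)) l

enum-injective : ∀ {n} (p : Fin n → Bool) → Injective _≡_ _≡_ (enum p)
enum-injective {suc n} p {l} {l′} eq with p zero
enum-injective {suc n} p {zero}  {zero}   eq | true = refl
enum-injective {suc n} p {suc l} {suc l′} eq | true =
  cong suc (enum-injective (λ i → p (suc i)) (suc-injective eq))
enum-injective {suc n} p {l}     {l′}     eq | false =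
  enum-injective (λ i → p (suc i)) (suc-injective eq)

enum-surjective : ∀ {n} (p : Fin n → Bool) x → p x ≡ true → Σ (Fin (count p)) λ l → enum p l ≡ x
enum-surjective {suc n} p x px with p zero in eq
enum-surjective {suc n} p zero    px | true = zero , refl
enum-surjective {suc n} p (suc x) px | true with enum-surjective (λ i → p (suc i)) x px
... | l , refl = suc l , refl
enum-surjective {suc n} p zero    px | false with () ← trans (sym eq) px
enum-surjective {suc n} p (suc x) px | false with enum-surjective (λ i → p (suc i)) x px
... | l , refl = l , refl

count-false : ∀ {n} (p : Fin n → Bool) → (∀ i → p i ≡ false) → count p ≡ 0
count-false {zero}  p all-false = refl
count-false {suc n} p all-false rewrite all-false zero = count-false (λ i → p (suc i)) (λ i → all-false (suc i))

count-below-enum : ∀ {n} (p : Fin n → Bool) l → count (λ i → (toℕ i <ᵇ toℕ (enum p l)) ∧ p i) ≡ toℕ l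
count-below-enum {suc n} p l with p zero
count-below-enum {suc n} p zero    | true = count-false (λ i → (suc (toℕ i) <ᵇ 0) ∧ p (suc i)) (λ i → refl)
count-below-enum {suc n} p (suc l) | true = cong suc (count-below-enum (λ i → p (suc i)) l)
count-below-enum {suc n} p l       | false = count-below-enum (λ i → p (suc i)) l

enumeration⇒count≡ : ∀ {m n} (p : Fin m → Bool) (e : Fin n → Fin m) → Injective _≡_ _≡_ e →
                     (∀ i → p (e i) ≡ true) → (∀ x → p x ≡ true → Σ (Fin n) λ i → e i ≡ x) →
                     count p ≡ n
enumeration⇒count≡ p e e-inj p∘e covered = ≤-antisym (injective⇒≤ to-inj) (injective⇒≤ from-inj)
  where
  to : Fin (count p) → _
  to l = proj₁ (covered (enum p l) (enum-satisfies p l))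
  to-inj : Injective _≡_ _≡_ to
  to-inj {l} {l′} eq = enum-injective p (begin
    enum p l       ≡⟨ sym (proj₂ (covered (enum p l) _)) ⟩
    e (to l)       ≡⟨ cong e eq ⟩
    e (to l′)      ≡⟨ proj₂ (covered (enum p l′) _) ⟩
    enum p l′      ∎)
    where open ≡-Reasoning
  from : Fin _ → Fin (count p)
  from i = proj₁ (enum-surjective p (e i) (p∘e i))
  from-inj : Injective _≡_ _≡_ from
  from-inj {i} {i′} eq = e-inj (begin
    e i               ≡⟨ sym (proj₂ (enum-surjective p (e i) _)) ⟩
    enum p (from i)   ≡⟨ cong (enum p) eq ⟩
    enum p (from i′)  ≡⟨ proj₂ (enum-surjective p (e i′) _) ⟩
    e i′              ∎)
    where open ≡-Reasoning

_∉-image_ : ∀ {j n} → Fin n → (Fin j → Fin n) → Set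
x ∉-image g = ∀ l → g l ≢ x

preimage-just : ∀ {k n} (g : Fin k → Fin n) {x i} → preimage g x ≡ just i → g i ≡ x
preimage-just {suc k} g {x} eq with g zero ≟ x
preimage-just {suc k} g refl | yes gz≡x = gz≡x
... | no _ with preimage (λ i → g (suc i)) x in eq′
preimage-just {suc k} g refl | no _ | just i = preimage-just (λ i → g (suc i)) eq′

preimage-nothing : ∀ {k n} (g : Fin k → Fin n) {x} → preimage g x ≡ nothing → x ∉-image g
preimage-nothing {suc k} g {x} eq i gi≡x with g zero ≟ x
preimage-nothing {suc k} g () i gi≡x | yes _
... | no gz≢x with preimage (λ i → g (suc i)) x in eq′
preimage-nothing {suc k} g refl zero    gi≡x | no gz≢x | nothing = gz≢x gi≡x
preimage-nothing {suc k} g refl (suc i) gi≡x | no gz≢x | nothing = preimage-nothing (λ i → g (suc i)) eq′ i gi≡x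

∉-image⇒preimage≡nothing : ∀ {k n} (g : Fin k → Fin n) {x} → x ∉-image g → preimage g x ≡ nothing
∉-image⇒preimage≡nothing {zero}  g x∉ = refl
∉-image⇒preimage≡nothing {suc k} g {x} x∉ with g zero ≟ x
... | yes gz≡x = ⊥-elim (x∉ zero gz≡x)
... | no _ rewrite ∉-image⇒preimage≡nothing (λ i → g (suc i)) (λ i → x∉ (suc i)) = refl

preimage-injective : ∀ {k n} (g : Fin k → Fin n) → Injective _≡_ _≡_ g → ∀ i → preimage g (g i) ≡ just i
preimage-injective g g-inj i with preimage g (g i) in eq
... | just i′   = cong just (g-inj (preimage-just g eq))
... | nothing  = ⊥-elim (preimage-nothing g eq i refl)

data Preimage {k n} (g : Fin k → Fin n) : Fin n → Set where
  outside : ∀ {x} → x ∉-image g → Preimage g x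
  image   : ∀ i → Preimage g (g i)

preimage-view : ∀ {k n} (g : Fin k → Fin n) x → Preimage g x
preimage-view g x with preimage g x in eq
... | nothing = outside (preimage-nothing g eq)
... | just i with refl ← preimage-just g eq = image i

IsEnd : (Γ : Graph) → Fin (nE Γ) → Fin (nV Γ) → Set
IsEnd Γ ε v = proj₁ (ends Γ ε) ≡ v ⊎ proj₂ (ends Γ ε) ≡ v

incident⇒IsEnd : (Γ : Graph) {v : Fin (nV Γ)} {ε : Fin (nE Γ)} → incident Γ v ε ≡ true → IsEnd Γ ε v
incident⇒IsEnd Γ {v} {ε} inc with proj₁ (ends Γ ε) ≟ v | proj₂ (ends Γ ε) ≟ v
... | yes z₁≡v | _        = inj₁ z₁≡v
... | no _     | yes z₂≡v = inj₂ z₂≡v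

IsEnd⇒incident : (Γ : Graph) {v : Fin (nV Γ)} {ε : Fin (nE Γ)} → IsEnd Γ ε v → incident Γ v ε ≡ true
IsEnd⇒incident Γ {v} {ε} end with proj₁ (ends Γ ε) ≟ v | proj₂ (ends Γ ε) ≟ v | end
... | yes _ | _     | _           = refl
... | no _  | yes _ | _           = refl
... | no z₁≢v | no _ | inj₁ z₁≡v = ⊥-elim (z₁≢v z₁≡v)
... | no _ | no z₂≢v | inj₂ z₂≡v = ⊥-elim (z₂≢v z₂≡v)

IsEnd-unfold : (Γ : Graph) {ε : Fin (nE Γ)} {v a b : Fin (nV Γ)} → ends Γ ε ≡ (a , b) → IsEnd Γ ε v → a ≡ v ⊎ b ≡ v
IsEnd-unfold Γ {v = v} eq = subst (λ ab → proj₁ ab ≡ v ⊎ proj₂ ab ≡ v) eq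

record CoversOnce (Γ : Graph) (N : Fin (nE Γ) → Bool) (S : Fin (nV Γ) → Set) : Set where
  field
    mate        : Fin (nV Γ) → Fin (nE Γ)
    mate-∈      : ∀ {v} → S v → N (mate v) ≡ true
    mate-end    : ∀ {v} → S v → IsEnd Γ (mate v) v
    mate-unique : ∀ {ε v} → N ε ≡ true → IsEnd Γ ε v → S v → mate v ≡ ε

count≡1⇒unique : ∀ {n} (p : Fin n → Bool) → count p ≡ 1 →
                 Σ (Fin n) λ a → p a ≡ true × (∀ x → p x ≡ true → x ≡ a)
count≡1⇒unique p count≡1 = enum p l₀ , enum-satisfies p l₀ , unique
  where
  l₀ = cast (sym count≡1) zero
  singleton : ∀ {n} → n ≡ 1 → (l l′ : Fin n) → l ≡ l′
  singleton refl zero zero = refl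
  unique : ∀ x → p x ≡ true → x ≡ enum p l₀
  unique x px with enum-surjective p x px
  ... | l , refl = cong (enum p) (singleton count≡1 l l₀)

perfectMatching⇒coversOnce : (Γ : Graph) (N : Fin (nE Γ) → Bool) → PerfectMatching Γ N → CoversOnce Γ N U
perfectMatching⇒coversOnce Γ N pm = record
  { mate        = λ v → proj₁ (unique v)
  ; mate-∈      = λ {v} _ → ∧-conicalˡ _ _ (proj₁ (proj₂ (unique v)))
  ; mate-end    = λ {v} _ → incident⇒IsEnd Γ (∧-conicalʳ _ _ (proj₁ (proj₂ (unique v))))
  ; mate-unique = λ {ε} {v} Nε end _ → sym (proj₂ (proj₂ (unique v)) ε (cong₂ _∧_ Nε (IsEnd⇒incident Γ end)))
  }
  where
  unique : ∀ v → _
  unique v = count≡1⇒unique (λ e → N e ∧ incident Γ v e) (pm v)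

coversOnce⇒perfectMatching : (Γ : Graph) (N : Fin (nE Γ) → Bool) → CoversOnce Γ N U → PerfectMatching Γ N
coversOnce⇒perfectMatching Γ N covers v =
  enumeration⇒count≡ _ (λ _ → mate v) (λ { {zero} {zero} _ → refl })
    (λ _ → cong₂ _∧_ (mate-∈ tt) (IsEnd⇒incident Γ (mate-end tt)))
    (λ ε Nε∧inc → zero , mate-unique (∧-conicalˡ _ _ Nε∧inc) (incident⇒IsEnd Γ (∧-conicalʳ _ _ Nε∧inc)) tt)
  where open CoversOnce covers

↑ˡ≢↑ʳ : ∀ {a b} (x : Fin a) (y : Fin b) → x ↑ˡ b ≢ a ↑ʳ y
↑ˡ≢↑ʳ {a} {b} x y eq with () ← trans (sym (splitAt-↑ˡ a x b)) (trans (cong (splitAt a) eq) (splitAt-↑ʳ a b y))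

quotRem-combine : ∀ {a b} (i : Fin a) (t : Fin b) → quotRem b (combine i t) ≡ (t , i)
quotRem-combine i t = cong swap (remQuot-combine i t)

blockCase : ∀ {A : Set} a b c → (Fin a → A) → (Fin b → Fin c → A) → Fin (a + b * c) → A
blockCase a b c l r = [ l , uncurry r ∘ remQuot c ]′ ∘ splitAt a

blockCase-↑ˡ : ∀ {A : Set} a b c (l : Fin a → A) (r : Fin b → Fin c → A) x →
               blockCase a b c l r (x ↑ˡ b * c) ≡ l x
blockCase-↑ˡ a b c l r x rewrite splitAt-↑ˡ a x (b * c) = refl

blockCase-↑ʳ : ∀ {A : Set} a b c (l : Fin a → A) (r : Fin b → Fin c → A) i t →
               blockCase a b c l r (a ↑ʳ combine i t) ≡ r i t
blockCase-↑ʳ a b c l r i t rewrite splitAt-↑ʳ a (b * c) (combine i t) = cong (uncurry r) (remQuot-combine i t)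

data BlockView (a b c : ℕ) : Fin (a + b * c) → Set where
  left  : (x : Fin a) → BlockView a b c (x ↑ˡ b * c)
  right : (i : Fin b) (t : Fin c) → BlockView a b c (a ↑ʳ combine i t)

blockView : ∀ a b c x → BlockView a b c x
blockView a b c x = subst (BlockView a b c) (join-splitAt a (b * c) x) (view (splitAt a x))
  where
  view : ∀ s → BlockView a b c (join a (b * c) s)
  view (inj₁ y) = left y
  view (inj₂ d) = subst (λ d → BlockView a b c (a ↑ʳ d)) (combine-remQuot {b} c d) (right _ _)

module Expansion (Γ : Graph) (j : ℕ) (g : Fin j → Fin (nV Γ)) (g-inj : Injective _≡_ _≡_ g)
                 (N : Fin (nE Γ) → Bool) (covers : CoversOnce Γ N (_∉-image g))
                 (degree-g : ∀ l → degree Γ (g l) ≡ 3)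
                 (saturated : ∀ l {ε} → incident Γ (g l) ε ≡ true → N ε ≡ true) where

  open CoversOnce covers

  X : Graph
  X = expand Γ j g

  orig : Fin (nV Γ) → Fin (nV X)
  orig y = y ↑ˡ j * 2

  origE : Fin (nE Γ) → Fin (nE X)
  origE ε = ε ↑ˡ j * 3

  corner : Fin j → Fin 3 → Fin (nV X)
  corner l 0F      = orig (g l)
  corner l (suc s) = nV Γ ↑ʳ combine l s

  -- A copy of the rule local to expand, which cannot be referred to from outside Defs.
  attach : Fin (nE Γ) → Fin (nV Γ) → Fin (nV X)
  attach ε z with preimage g z
  ... | nothing = orig z
  ... | just l with position Γ z ε
  ...   | zero        = orig z
  ...   | suc zero    = corner l 1F
  ...   | suc (suc _) = corner l 2F

  proj₁-ends-origE : ∀ ε → proj₁ (ends X (origE ε)) ≡ attach ε (proj₁ (ends Γ ε))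
  proj₁-ends-origE ε rewrite splitAt-↑ˡ (nE Γ) ε (j * 3) with preimage g (proj₁ (ends Γ ε))
  ... | nothing = refl
  ... | just l with position Γ (proj₁ (ends Γ ε)) ε
  ...   | zero        = refl
  ...   | suc zero    = refl
  ...   | suc (suc _) = refl

  proj₂-ends-origE : ∀ ε → proj₂ (ends X (origE ε)) ≡ attach ε (proj₂ (ends Γ ε))
  proj₂-ends-origE ε rewrite splitAt-↑ˡ (nE Γ) ε (j * 3) with preimage g (proj₂ (ends Γ ε))
  ... | nothing = refl
  ... | just l with position Γ (proj₂ (ends Γ ε)) ε
  ...   | zero        = refl
  ...   | suc zero    = refl
  ...   | suc (suc _) = refl

  IsEnd-attach : ∀ {ε z} → IsEnd Γ ε z → IsEnd X (origE ε) (attach ε z)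
  IsEnd-attach {ε} (inj₁ refl) = inj₁ (proj₁-ends-origE ε)
  IsEnd-attach {ε} (inj₂ refl) = inj₂ (proj₂-ends-origE ε)

  IsEnd-origE : ∀ {ε v} → IsEnd X (origE ε) v → Σ (Fin (nV Γ)) λ z → IsEnd Γ ε z × attach ε z ≡ v
  IsEnd-origE {ε} (inj₁ refl) = _ , inj₁ refl , sym (proj₁-ends-origE ε)
  IsEnd-origE {ε} (inj₂ refl) = _ , inj₂ refl , sym (proj₂-ends-origE ε)

  attach-outside : ∀ ε {z} → z ∉-image g → attach ε z ≡ orig z
  attach-outside ε z∉ rewrite ∉-image⇒preimage≡nothing g z∉ = refl

  spoke : Fin j → Fin 3 → Fin (nE Γ)
  spoke l p = enum (incident Γ (g l)) (cast (sym (degree-g l)) p)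

  spoke-incident : ∀ l p → incident Γ (g l) (spoke l p) ≡ true
  spoke-incident l p = enum-satisfies (incident Γ (g l)) _

  position-spoke : ∀ l p → position Γ (g l) (spoke l p) ≡ toℕ p
  position-spoke l p = trans (count-below-enum (incident Γ (g l)) _) (toℕ-cast _ p)

  spoke-surjective : ∀ l {ε} → incident Γ (g l) ε ≡ true → Σ (Fin 3) λ p → spoke l p ≡ ε
  spoke-surjective l inc with enum-surjective (incident Γ (g l)) _ inc
  ... | l′ , refl = cast (degree-g l) l′ , cong (enum (incident Γ (g l))) (cast-involutive (sym (degree-g l)) (degree-g l) l′)

  attach-spoke : ∀ l p → attach (spoke l p) (g l) ≡ corner l p
  attach-spoke l 0F rewrite preimage-injective g g-inj l | position-spoke l 0F = refl
  attach-spoke l 1F rewrite preimage-injective g g-inj l | position-spoke l 1F = refl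
  attach-spoke l 2F rewrite preimage-injective g g-inj l | position-spoke l 2F = refl

  Nₓ : Fin (nE X) → Bool
  Nₓ = blockCase (nE Γ) j 3 N (λ _ _ → false)

  Nₓ-origE : ∀ ε → Nₓ (origE ε) ≡ N ε
  Nₓ-origE = blockCase-↑ˡ (nE Γ) j 3 N (λ _ _ → false)

  mateOrig : Fin (nV Γ) → Fin (nE X)
  mateOrig y with preimage g y
  ... | nothing = origE (mate y)
  ... | just l  = origE (spoke l 0F)

  mateTriangle : Fin j → Fin 2 → Fin (nE X)
  mateTriangle l s = origE (spoke l (suc s))

  mateX : Fin (nV X) → Fin (nE X)
  mateX = blockCase (nV Γ) j 2 mateOrig mateTriangle

  mateX-outside : ∀ {y} → y ∉-image g → mateX (orig y) ≡ origE (mate y)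
  mateX-outside {y} y∉
    rewrite blockCase-↑ˡ (nV Γ) j 2 mateOrig mateTriangle y | ∉-image⇒preimage≡nothing g y∉ = refl

  mateX-corner : ∀ l p → mateX (corner l p) ≡ origE (spoke l p)
  mateX-corner l 0F
    rewrite blockCase-↑ˡ (nV Γ) j 2 mateOrig mateTriangle (g l) | preimage-injective g g-inj l = refl
  mateX-corner l (suc s) = blockCase-↑ʳ (nV Γ) j 2 mateOrig mateTriangle l s

  data VertexX : Fin (nV X) → Set where
    outside   : ∀ {y} → y ∉-image g → VertexX (orig y)
    at-corner : ∀ l p → VertexX (corner l p)

  vertexX : ∀ v → VertexX v
  vertexX v with blockView (nV Γ) j 2 v
  ... | right l s = at-corner l (suc s)
  ... | left y with preimage-view g y
  ...   | outside y∉ = outside y∉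
  ...   | image l    = at-corner l 0F

  mateX-ok : ∀ v → Nₓ (mateX v) ≡ true × IsEnd X (mateX v) v
  mateX-ok v with vertexX v
  ... | outside {y} y∉ rewrite mateX-outside y∉ | Nₓ-origE (mate y) =
    mate-∈ y∉ , subst (IsEnd X (origE (mate y))) (attach-outside (mate y) y∉) (IsEnd-attach (mate-end y∉))
  ... | at-corner l p rewrite mateX-corner l p | Nₓ-origE (spoke l p) =
    saturated l (spoke-incident l p) ,
    subst (IsEnd X (origE (spoke l p))) (attach-spoke l p) (IsEnd-attach (incident⇒IsEnd Γ (spoke-incident l p)))

  mateX-unique : ∀ {ε v} → Nₓ ε ≡ true → IsEnd X ε v → mateX v ≡ ε
  mateX-unique {ε} Nε end with blockView (nE Γ) j 3 ε
  ... | right l t rewrite blockCase-↑ʳ (nE Γ) j 3 N (λ _ _ → false) l t with () ← Nε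
  ... | left ε₀ with IsEnd-origE end
  ...   | z , z-end , refl with preimage-view g z
  ...     | outside z∉ rewrite attach-outside ε₀ z∉ =
    trans (mateX-outside z∉) (cong origE (mate-unique (trans (sym (Nₓ-origE ε₀)) Nε) z-end z∉))
  ...     | image l with spoke-surjective l (IsEnd⇒incident Γ z-end)
  ...       | p , refl rewrite attach-spoke l p = mateX-corner l p

  coversX : CoversOnce X Nₓ U
  coversX = record
    { mate        = mateX
    ; mate-∈      = λ {v} _ → proj₁ (mateX-ok v)
    ; mate-end    = λ {v} _ → proj₂ (mateX-ok v)
    ; mate-unique = λ Nε end _ → mateX-unique Nε end
    }

expand-hasPerfectMatching : (Γ : Graph) (j : ℕ) (g : Fin j → Fin (nV Γ)) → Injective _≡_ _≡_ g →
                            (N : Fin (nE Γ) → Bool) → CoversOnce Γ N (_∉-image g) →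
                            (∀ l → degree Γ (g l) ≡ 3) →
                            (∀ l {ε} → incident Γ (g l) ε ≡ true → N ε ≡ true) →
                            HasPerfectMatching (expand Γ j g)
expand-hasPerfectMatching Γ j g g-inj N covers degree-g saturated = Nₓ , coversOnce⇒perfectMatching X Nₓ coversX
  where open Expansion Γ j g g-inj N covers degree-g saturated

module Gadgets (G : Graph) (k : ℕ) (f : Fin k → Fin (nE G)) where

  H : Graph
  H = buildH G k f

  src tgt : Fin (nE G) → Fin (nV G)
  src e = proj₁ (ends G e)
  tgt e = proj₂ (ends G e)

  old : Fin (nV G) → Fin (nV H)
  old x = x ↑ˡ k * 4

  gadget : Fin k → Fin 4 → Fin (nV H)
  gadget i t = nV G ↑ʳ combine i t

  w : Fin k → Fin (nV H)
  w i = gadget i 0F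

  oldE : Fin (nE G) → Fin (nE H)
  oldE e = e ↑ˡ k * 6

  newE : Fin k → Fin 6 → Fin (nE H)
  newE i t = nE G ↑ʳ combine i t

  old≢gadget : ∀ {x i t} → old x ≢ gadget i t
  old≢gadget = ↑ˡ≢↑ʳ _ _

  gadget-injective : ∀ {i i′ t t′} → gadget i t ≡ gadget i′ t′ → i ≡ i′ × t ≡ t′
  gadget-injective eq = combine-injective _ _ _ _ (↑ʳ-injective (nV G) _ _ eq)

  oldE≢newE : ∀ {e i t} → oldE e ≢ newE i t
  oldE≢newE = ↑ˡ≢↑ʳ _ _

  newE-injective : ∀ {i i′ t t′} → newE i t ≡ newE i′ t′ → i ≡ i′ × t ≡ t′
  newE-injective eq = combine-injective _ _ _ _ (↑ʳ-injective (nE G) _ _ eq)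

  gadgetEnds : Fin k → Fin 6 → Fin (nV H) × Fin (nV H)
  gadgetEnds i 0F = w i , old (tgt (f i))
  gadgetEnds i 1F = w i , gadget i 1F
  gadgetEnds i 2F = gadget i 1F , gadget i 2F
  gadgetEnds i 3F = gadget i 1F , gadget i 3F
  gadgetEnds i 4F = gadget i 2F , gadget i 3F
  gadgetEnds i 5F = gadget i 2F , gadget i 3F

  ends-oldE-kept : ∀ {e} → preimage f e ≡ nothing → ends H (oldE e) ≡ (old (src e) , old (tgt e))
  ends-oldE-kept {e} pe rewrite splitAt-↑ˡ (nE G) e (k * 6) | pe = refl

  ends-oldE-subdivided : ∀ {e i} → preimage f e ≡ just i → ends H (oldE e) ≡ (old (src e) , w i)
  ends-oldE-subdivided {e} pe rewrite splitAt-↑ˡ (nE G) e (k * 6) | pe = refl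

  ends-newE : ∀ i t → ends H (newE i t) ≡ gadgetEnds i t
  ends-newE i t rewrite splitAt-↑ʳ (nE G) (k * 6) (combine i t) | quotRem-combine {k} {6} i t with t
  ... | 0F = refl
  ... | 1F = refl
  ... | 2F = refl
  ... | 3F = refl
  ... | 4F = refl
  ... | 5F = refl

  gadget-suc≢w : ∀ {i i′ s} → gadget i′ (suc s) ≢ w i
  gadget-suc≢w eq with () ← proj₂ (gadget-injective eq)

  wEdge : Fin k → Fin 3 → Fin (nE H)
  wEdge i 0F      = oldE (f i)
  wEdge i (suc s) = newE i (s ↑ˡ 4)

  wEdge-injective : ∀ i → Injective _≡_ _≡_ (wEdge i)
  wEdge-injective i {0F}    {0F}     _  = refl
  wEdge-injective i {0F}    {suc _}  eq = ⊥-elim (oldE≢newE eq)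
  wEdge-injective i {suc _} {0F}     eq = ⊥-elim (oldE≢newE (sym eq))
  wEdge-injective i {suc s} {suc s′} eq = cong suc (↑ˡ-injective 4 s s′ (proj₂ (newE-injective eq)))

  wEdge-end : Injective _≡_ _≡_ f → ∀ i p → IsEnd H (wEdge i p) (w i)
  wEdge-end f-inj i 0F rewrite ends-oldE-subdivided (preimage-injective f f-inj i) = inj₂ refl
  wEdge-end _     i 1F rewrite ends-newE i 0F = inj₁ refl
  wEdge-end _     i 2F rewrite ends-newE i 1F = inj₁ refl

  gadgetEdge-at-w : ∀ {i i′} t → proj₁ (gadgetEnds i′ t) ≡ w i ⊎ proj₂ (gadgetEnds i′ t) ≡ w i →
                    Σ (Fin 3) λ p → wEdge i p ≡ newE i′ t
  gadgetEdge-at-w 0F (inj₁ eq) with refl ← proj₁ (gadget-injective eq) = 1F , refl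
  gadgetEdge-at-w 0F (inj₂ eq) = ⊥-elim (old≢gadget eq)
  gadgetEdge-at-w 1F (inj₁ eq) with refl ← proj₁ (gadget-injective eq) = 2F , refl
  gadgetEdge-at-w 1F (inj₂ eq) = ⊥-elim (gadget-suc≢w eq)
  gadgetEdge-at-w 2F end = ⊥-elim ([ gadget-suc≢w , gadget-suc≢w ]′ end)
  gadgetEdge-at-w 3F end = ⊥-elim ([ gadget-suc≢w , gadget-suc≢w ]′ end)
  gadgetEdge-at-w 4F end = ⊥-elim ([ gadget-suc≢w , gadget-suc≢w ]′ end)
  gadgetEdge-at-w 5F end = ⊥-elim ([ gadget-suc≢w , gadget-suc≢w ]′ end)

  IsEnd-w : ∀ {i ε} → IsEnd H ε (w i) → Σ (Fin 3) λ p → wEdge i p ≡ ε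
  IsEnd-w {i} {ε} end with blockView (nE G) k 6 ε
  ... | right i′ t = gadgetEdge-at-w t (IsEnd-unfold H (ends-newE i′ t) end)
  ... | left e with preimage f e in pe
  ...   | nothing = ⊥-elim ([ old≢gadget , old≢gadget ]′ (IsEnd-unfold H (ends-oldE-kept pe) end))
  ...   | just i′ with IsEnd-unfold H (ends-oldE-subdivided pe) end
  ...     | inj₁ eq = ⊥-elim (old≢gadget eq)
  ...     | inj₂ eq with refl ← proj₁ (gadget-injective eq) | refl ← preimage-just f pe = 0F , refl

  degree-w : Injective _≡_ _≡_ f → ∀ i → degree H (w i) ≡ 3
  degree-w f-inj i = enumeration⇒count≡ (incident H (w i)) (wEdge i) (wEdge-injective i)
    (λ p → IsEnd⇒incident H (wEdge-end f-inj i p))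
    (λ ε inc → IsEnd-w (incident⇒IsEnd H inc))

module GadgetMatching (G : Graph) (loopless : Loopless G) (k : ℕ) (f : Fin k → Fin (nE G))
                      (f-inj : Injective _≡_ _≡_ f) (M : Fin (nE G) → Bool) (pm : PerfectMatching G M) where

  open Gadgets G k f
  open CoversOnce (perfectMatching⇒coversOnce G M pm)
    renaming (mate to mateG; mate-∈ to mateG-∈; mate-end to mateG-end; mate-unique to mateG-unique)

  gadgetMatching : Bool → Fin 6 → Bool
  gadgetMatching e∈M 0F = e∈M
  gadgetMatching _   1F = true
  gadgetMatching _   4F = true
  gadgetMatching _   _  = false

  MH : Fin (nE H) → Bool
  MH = blockCase (nE G) k 6 M (λ i → gadgetMatching (M (f i)))

  MH-oldE : ∀ e → MH (oldE e) ≡ M e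
  MH-oldE = blockCase-↑ˡ (nE G) k 6 M (λ i → gadgetMatching (M (f i)))

  MH-newE : ∀ i t → MH (newE i t) ≡ gadgetMatching (M (f i)) t
  MH-newE = blockCase-↑ʳ (nE G) k 6 M (λ i → gadgetMatching (M (f i)))

  matchedW : Fin (countIn f M) → Fin (nV H)
  matchedW l = w (enum (M ∘ f) l)

  matchedW-injective : Injective _≡_ _≡_ matchedW
  matchedW-injective eq = enum-injective (M ∘ f) (proj₁ (gadget-injective eq))

  matched⇒w∈ : ∀ {i} → M (f i) ≡ true → w i ∉-image matchedW → ⊥
  matched⇒w∈ {i} M∋fi w∉ with enum-surjective (M ∘ f) i M∋fi
  ... | l , refl = w∉ l refl

  liftMate : Fin (nV G) → Fin (nE G) → Fin (nE H)
  liftMate x e with preimage f e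
  ... | nothing = oldE e
  ... | just i with x ≟ src e
  ...   | yes _ = oldE e
  ...   | no _  = newE i 0F

  liftMate-kept : ∀ {x e} → preimage f e ≡ nothing → liftMate x e ≡ oldE e
  liftMate-kept pe rewrite pe = refl

  liftMate-src : ∀ e → liftMate (src e) e ≡ oldE e
  liftMate-src e with preimage f e
  ... | nothing = refl
  ... | just i with src e ≟ src e
  ...   | yes _ = refl
  ...   | no src≢src = ⊥-elim (src≢src refl)

  liftMate-tgt : ∀ i → liftMate (tgt (f i)) (f i) ≡ newE i 0F
  liftMate-tgt i rewrite preimage-injective f f-inj i with tgt (f i) ≟ src (f i)
  ... | yes tgt≡src = ⊥-elim (loopless (f i) (sym tgt≡src))
  ... | no _ = refl

  -- The value at w_e is junk when e ∈ M: then w_e lies in U and has no mate.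
  gadgetMate : Fin k → Fin 4 → Fin (nE H)
  gadgetMate i 0F = newE i 1F
  gadgetMate i 1F = newE i 1F
  gadgetMate i _  = newE i 4F

  mateH : Fin (nV H) → Fin (nE H)
  mateH = blockCase (nV G) k 4 (λ x → liftMate x (mateG x)) gadgetMate

  mateH-old : ∀ x → mateH (old x) ≡ liftMate x (mateG x)
  mateH-old = blockCase-↑ˡ (nV G) k 4 (λ x → liftMate x (mateG x)) gadgetMate

  mateH-gadget : ∀ i t → mateH (gadget i t) ≡ gadgetMate i t
  mateH-gadget = blockCase-↑ʳ (nV G) k 4 (λ x → liftMate x (mateG x)) gadgetMate

  liftMate-ok : ∀ {x e} → M e ≡ true → IsEnd G e x → MH (liftMate x e) ≡ true × IsEnd H (liftMate x e) (old x)
  liftMate-ok {x} {e} M∋e end with preimage f e in pe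
  ... | nothing rewrite MH-oldE e | ends-oldE-kept pe = M∋e , Sum.map (cong old) (cong old) end
  ... | just i with x ≟ src e
  ...   | yes refl rewrite MH-oldE e | ends-oldE-subdivided pe = M∋e , inj₁ refl
  ...   | no x≢src with refl ← preimage-just f pe rewrite MH-newE i 0F | ends-newE i 0F =
    M∋e , inj₂ (cong old ([ (λ src≡x → ⊥-elim (x≢src (sym src≡x))) , id ]′ end))

  mateH-ok : ∀ v → MH (mateH v) ≡ true × IsEnd H (mateH v) v
  mateH-ok v with blockView (nV G) k 4 v
  ... | left x rewrite mateH-old x = liftMate-ok (mateG-∈ tt) (mateG-end tt)
  ... | right i 0F rewrite mateH-gadget i 0F | MH-newE i 1F | ends-newE i 1F = refl , inj₁ refl
  ... | right i 1F rewrite mateH-gadget i 1F | MH-newE i 1F | ends-newE i 1F = refl , inj₂ refl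
  ... | right i 2F rewrite mateH-gadget i 2F | MH-newE i 4F | ends-newE i 4F = refl , inj₁ refl
  ... | right i 3F rewrite mateH-gadget i 3F | MH-newE i 4F | ends-newE i 4F = refl , inj₂ refl

  mateH-old-unique : ∀ {e x} → M e ≡ true → IsEnd G e x → mateH (old x) ≡ liftMate x e
  mateH-old-unique M∋e end = trans (mateH-old _) (cong (liftMate _) (mateG-unique M∋e end tt))

  mateH-unique-oldE : ∀ {e v} → M e ≡ true → IsEnd H (oldE e) v → v ∉-image matchedW → mateH v ≡ oldE e
  mateH-unique-oldE {e} M∋e end v∉ with preimage f e in pe
  ... | nothing with IsEnd-unfold H (ends-oldE-kept pe) end
  ...   | inj₁ refl = trans (mateH-old-unique M∋e (inj₁ refl)) (liftMate-kept pe)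
  ...   | inj₂ refl = trans (mateH-old-unique M∋e (inj₂ refl)) (liftMate-kept pe)
  mateH-unique-oldE {e} M∋e end v∉ | just i with IsEnd-unfold H (ends-oldE-subdivided pe) end
  ...   | inj₁ refl = trans (mateH-old-unique M∋e (inj₁ refl)) (liftMate-src e)
  ...   | inj₂ refl with refl ← preimage-just f pe = ⊥-elim (matched⇒w∈ M∋e v∉)

  mateH-unique-newE : ∀ {i t v} → gadgetMatching (M (f i)) t ≡ true → IsEnd H (newE i t) v →
                v ∉-image matchedW → mateH v ≡ newE i t
  mateH-unique-newE {i} {0F} M∋fi end v∉ with IsEnd-unfold H (ends-newE i 0F) end
  ... | inj₁ refl = ⊥-elim (matched⇒w∈ M∋fi v∉)
  ... | inj₂ refl = trans (mateH-old-unique M∋fi (inj₂ refl)) (liftMate-tgt i)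
  mateH-unique-newE {i} {1F} _ end _ with IsEnd-unfold H (ends-newE i 1F) end
  ... | inj₁ refl = mateH-gadget i 0F
  ... | inj₂ refl = mateH-gadget i 1F
  mateH-unique-newE {i} {4F} _ end _ with IsEnd-unfold H (ends-newE i 4F) end
  ... | inj₁ refl = mateH-gadget i 2F
  ... | inj₂ refl = mateH-gadget i 3F
  mateH-unique-newE {t = 2F} () _ _
  mateH-unique-newE {t = 3F} () _ _
  mateH-unique-newE {t = 5F} () _ _

  mateH-unique : ∀ {ε v} → MH ε ≡ true → IsEnd H ε v → v ∉-image matchedW → mateH v ≡ ε
  mateH-unique {ε} MH∋ε end v∉ with blockView (nE G) k 6 ε
  ... | left e    = mateH-unique-oldE (trans (sym (MH-oldE e)) MH∋ε) end v∉
  ... | right i t = mateH-unique-newE (trans (sym (MH-newE i t)) MH∋ε) end v∉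

  coversH : CoversOnce H MH (_∉-image matchedW)
  coversH = record
    { mate        = mateH
    ; mate-∈      = λ {v} _ → proj₁ (mateH-ok v)
    ; mate-end    = λ {v} _ → proj₂ (mateH-ok v)
    ; mate-unique = mateH-unique
    }

  matchedW-saturated : ∀ l {ε} → incident H (matchedW l) ε ≡ true → MH ε ≡ true
  matchedW-saturated l inc with IsEnd-w (incident⇒IsEnd H inc)
  ... | 0F , refl = trans (MH-oldE _) (enum-satisfies (M ∘ f) l)
  ... | 1F , refl = trans (MH-newE _ 0F) (enum-satisfies (M ∘ f) l)
  ... | 2F , refl = MH-newE _ 1F

lemma4p2 : (G : Graph) → Cubic G → Bridgeless G →
           (k : ℕ) (f : Fin k → Fin (nE G)) → Injective _≡_ _≡_ f →
           (M : Fin (nE G) → Bool) → PerfectMatching G M →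
           t≤ (buildH G k f) (countIn f M)
-- Bridgelessness only guarantees that G has a perfect matching, and M is given.
lemma4p2 G (loopless , _) _ k f f-inj M pm =
  countIn f M , ≤-refl , matchedW , matchedW-injective ,
  expand-hasPerfectMatching H (countIn f M) matchedW matchedW-injective MH coversH
    (λ l → degree-w f-inj _) matchedW-saturated
  where
  open Gadgets G k f
  open GadgetMatching G loopless k f f-inj M pm
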